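{- For $n\geq 1$, $\mathcal{Z}(P_n;x)=\sum_{i=1}^n\left(\binom{n}{i}-\binom{n-i-1}{i}\right)x^i$.
   Context: $P_n$ is the path on $n$ vertices. Zero forcing: given a set of colored vertices of a graph, a colored vertex $u$ with exactly one uncolored neighbor $v$ may force $v$, i.e. $v$ becomes colored. A set $S$ of vertices is a zero forcing set if starting with $S$ colored and repeatedly applying this rule eventually colors all vertices. For a graph $G$ on $n$ vertices, $z(G;i)$ is the number of zero forcing sets of size $i$ and $\mathcal{Z}(G;x)=\sum_{i=1}^n z(G;i)x^i$. Convention: $\binom{a}{b}=0$ whenever $a<b$ (including when $a$ is negative). -}

module Defs where

open import Data.Nat using (ℕ; suc; _+_; _∸_)
open import Data.Fin using (Fin; toℕ)
open import Data.Fin.Subset using (Subset; _∈_; _∉_; ⁅_⁆; _∪_; ⊤; ∣_∣)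
open import Data.Product using (Σ; ∃; ∃-syntax; _×_)
open import Data.Sum using (_⊎_)
open import Data.List using (List; length)
open import Data.List.Relation.Unary.Unique.Propositional using (Unique)
import Data.List.Membership.Propositional as LM
open import Relation.Binary.PropositionalEquality using (_≡_; _≢_)
open import Relation.Binary.Construct.Closure.ReflexiveTransitive using (Star)
open import Function.Bundles using (_⇔_)

Graph : ℕ → Set₁
Graph n = Fin n → Fin n → Set

Path : (n : ℕ) → Graph n
Path n u v = (suc (toℕ u) ≡ toℕ v) ⊎ (suc (toℕ v) ≡ toℕ u)

-- One application of the color-change rule: a colored vertex u whose
-- only uncolored neighbour is v forces v.
data Force {n : ℕ} (G : Graph n) (C : Subset n) : Subset n → Set where
  force : (u v : Fin n) → u ∈ C → v ∉ C → G u v →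
          (∀ w → G u w → w ≢ v → w ∈ C) →
          Force G C (C ∪ ⁅ v ⁆)

IsZeroForcingSet : {n : ℕ} → Graph n → Subset n → Set
IsZeroForcingSet G S = Star (Force G) S ⊤

-- z(G;i) ≡ k : the zero forcing sets of G of size i are exactly the
-- entries of a duplicate-free list of length k.
ZCount : {n : ℕ} → Graph n → ℕ → ℕ → Set
ZCount {n} G i k =
  Σ (List (Subset n)) λ L →
    Unique L × length L ≡ k ×
    (∀ S → (S LM.∈ L) ⇔ (∣ S ∣ ≡ i × IsZeroForcingSet G S))

module Submission where

open import Defs
open import Data.Nat using (ℕ; _+_; _∸_; _≤_)
open import Data.Nat.Combinatorics using (_C_)
open import Data.Product using (Σ; _×_)
open import Relation.Binary.PropositionalEquality using (_≡_)

open import Data.Nat using (zero; suc; _<_; _≡ᵇ_; s≤s; z≤n; _<?_)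
open import Data.Nat.Properties
open import Data.Nat.Combinatorics using (k>n⇒nCk≡0; nCk+nC[k+1]≡[n+1]C[k+1])
open import Data.Bool using (Bool; true; false; not; _∧_; if_then_else_; T)
open import Data.Bool.Properties using (∧-zeroʳ; T-∧; T-not-≡)
open import Data.Unit using (tt)
open import Data.Vec using ([]; _∷_; here; there)
open import Data.Vec.Properties using (∷-injectiveʳ)
open import Data.List using (List; []; _∷_; _++_; map; length; filter)
open import Data.List.Relation.Unary.Unique.Propositional using (Unique)
import Data.List.Relation.Unary.Unique.Propositional.Properties as Unique
import Data.List.Relation.Unary.All as All
import Data.List.Relation.Unary.AllPairs as AllPairs
open import Data.List.Relation.Unary.Any using () renaming (here to hereₗ)
open import Data.List.Membership.Propositional using () renaming (_∈_ to _∈ₗ_)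
open import Data.List.Membership.Propositional.Properties
  using (∈-++⁺ˡ; ∈-++⁺ʳ; ∈-map⁺; ∈-map⁻; ∈-filter⁺; ∈-filter⁻)
open import Data.Fin using (Fin; zero; suc; toℕ; fromℕ<; inject₁)
open import Data.Fin.Properties using (toℕ-injective; toℕ<n; toℕ-fromℕ<; toℕ-inject₁)
open import Data.Fin.Subset using (Subset; _∈_; _∉_; _⊆_; ⊤; ∣_∣)
open import Data.Fin.Subset.Properties using (_∈?_; x∈p∪q⁺; x∈⁅x⁆; ∈⊤; ⊆⊤; ⊆-antisym)
open import Data.Product using (_,_; proj₂; uncurry)
open import Data.Sum using (_⊎_; inj₁; inj₂)
open import Data.Empty using (⊥; ⊥-elim)
open import Function using (_∘_)
open import Relation.Nullary using (¬_; yes; no)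
open import Relation.Nullary.Decidable using (T?)
open import Relation.Binary.PropositionalEquality
  using (refl; sym; trans; cong; cong₂; subst; _≢_; ≢-sym; module ≡-Reasoning)
open import Relation.Binary.Construct.Closure.ReflexiveTransitive using (ε; _◅_)
open import Function.Bundles using (_⇔_; mk⇔; Equivalence)
open import Function.Construct.Composition using (_⇔-∘_)

-- A set S is zero forcing exactly when it is not "stalled", where stalled
-- means: vertex 0 is uncolored, vertex m is uncolored and no two colored
-- vertices are adjacent.  A stalled set admits no force at all.  Any other
-- set contains a seed (vertex 0, vertex m, or an adjacent colored pair), and
-- the colored interval through the seed grows one vertex at a time, first to
-- the left and then to the right, until the whole path is colored.
--
-- Dropping vertex 0, stalled sets of size i are the "sparse" subsets of P_m
-- (no two adjacent elements, last vertex excluded) of size i; a Fibonacci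
-- type recursion shows there are C(m-i, i) of them.  As there are C(m+1, i)
-- sets of size i in total, the zero forcing sets of size i number
-- C(m+1, i) - C(m-i, i), which is the theorem (for every i, in fact).

count : {A : Set} → (A → Bool) → List A → ℕ
count p []       = 0
count p (x ∷ xs) = if p x then suc (count p xs) else count p xs

count-++ : {A : Set} (p : A → Bool) (xs ys : List A) →
           count p (xs ++ ys) ≡ count p xs + count p ys
count-++ p []       ys = refl
count-++ p (x ∷ xs) ys with p x
... | true  = cong suc (count-++ p xs ys)
... | false = count-++ p xs ys

count-map : {A B : Set} (p : B → Bool) (f : A → B) (xs : List A) →
            count p (map f xs) ≡ count (p ∘ f) xs
count-map p f []       = refl
count-map p f (x ∷ xs) with p (f x)
... | true  = cong suc (count-map p f xs)
... | false = count-map p f xs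

count-cong : {A : Set} {p q : A → Bool} → (∀ x → p x ≡ q x) →
             (xs : List A) → count p xs ≡ count q xs
count-cong p≗q []       = refl
count-cong {q = q} p≗q (x ∷ xs) rewrite p≗q x with q x
... | true  = cong suc (count-cong p≗q xs)
... | false = count-cong p≗q xs

count-false : {A : Set} (xs : List A) → count (λ _ → false) xs ≡ 0
count-false []       = refl
count-false (x ∷ xs) = count-false xs

count-partition : {A : Set} (b s : A → Bool) (xs : List A) →
  count (λ x → not (b x) ∧ s x) xs + count (λ x → b x ∧ s x) xs ≡ count s xs
count-partition b s []       = refl
count-partition b s (x ∷ xs) with b x | s x
... | true  | true  = trans (+-suc _ _) (cong suc (count-partition b s xs))
... | true  | false = count-partition b s xs
... | false | true  = cong suc (count-partition b s xs)
... | false | false = count-partition b s xs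

length-filter : {A : Set} (p : A → Bool) (xs : List A) →
                length (filter (T? ∘ p) xs) ≡ count p xs
length-filter p []       = refl
length-filter p (x ∷ xs) with p x
... | true  = cong suc (length-filter p xs)
... | false = length-filter p xs

subsets : (n : ℕ) → List (Subset n)
subsets zero    = [] ∷ []
subsets (suc n) = map (false ∷_) (subsets n) ++ map (true ∷_) (subsets n)

subsets-complete : ∀ {n} (S : Subset n) → S ∈ₗ subsets n
subsets-complete []                = hereₗ refl
subsets-complete {suc n} (false ∷ S) = ∈-++⁺ˡ (∈-map⁺ (false ∷_) (subsets-complete S))
subsets-complete {suc n} (true ∷ S)  =
  ∈-++⁺ʳ (map (false ∷_) (subsets n)) (∈-map⁺ (true ∷_) (subsets-complete S))

subsets-unique : ∀ n → Unique (subsets n)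
subsets-unique zero    = All.[] AllPairs.∷ AllPairs.[]
subsets-unique (suc n) =
  Unique.++⁺ (Unique.map⁺ ∷-injectiveʳ (subsets-unique n))
             (Unique.map⁺ ∷-injectiveʳ (subsets-unique n)) first-entries-differ
  where
  first-entries-differ : ∀ {S} → S ∈ₗ map (false ∷_) (subsets n) ×
                                 S ∈ₗ map (true ∷_) (subsets n) → ⊥
  first-entries-differ (p , q) with ∈-map⁻ (false ∷_) p | ∈-map⁻ (true ∷_) q
  ... | _ , _ , refl | _ , _ , ()

#subsets : (n : ℕ) → (Subset n → Bool) → ℕ
#subsets n p = count p (subsets n)

#subsets-suc : ∀ n (p : Subset (suc n) → Bool) →
  #subsets (suc n) p ≡ #subsets n (p ∘ (false ∷_)) + #subsets n (p ∘ (true ∷_))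
#subsets-suc n p = trans (count-++ p (map (false ∷_) (subsets n)) _)
  (cong₂ _+_ (count-map p (false ∷_) (subsets n)) (count-map p (true ∷_) (subsets n)))

enumerate : ∀ {n} (p : Subset n → Bool) →
  Σ (List (Subset n)) λ L →
    Unique L × length L ≡ #subsets n p × (∀ S → (S ∈ₗ L) ⇔ T (p S))
enumerate {n} p =
  filter (T? ∘ p) (subsets n) ,
  Unique.filter⁺ (T? ∘ p) (subsets-unique n) ,
  length-filter p (subsets n) ,
  λ S → mk⇔ (proj₂ ∘ ∈-filter⁻ (T? ∘ p) {xs = subsets n})
            (∈-filter⁺ (T? ∘ p) (subsets-complete S))

ofSize : ∀ {n} → ℕ → Subset n → Bool
ofSize i S = ∣ S ∣ ≡ᵇ i

-- There are C(n, i) subsets of size i (Pascal's rule, splitting on vertex 0).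
#ofSize : ∀ n i → #subsets n (ofSize i) ≡ n C i
#ofSize zero    zero    = refl
#ofSize zero    (suc i) = refl
#ofSize (suc n) zero    = trans (#subsets-suc n (ofSize 0))
  (cong₂ _+_ (#ofSize n 0) (count-false (subsets n)))
#ofSize (suc n) (suc i) = begin
  #subsets (suc n) (ofSize (suc i))               ≡⟨ #subsets-suc n (ofSize (suc i)) ⟩
  #subsets n (ofSize (suc i)) + #subsets n (ofSize i) ≡⟨ cong₂ _+_ (#ofSize n (suc i)) (#ofSize n i) ⟩
  n C suc i + n C i                               ≡⟨ +-comm (n C suc i) (n C i) ⟩
  n C i + n C suc i                               ≡⟨ nCk+nC[k+1]≡[n+1]C[k+1] n i ⟩
  suc n C suc i                                   ∎
  where open ≡-Reasoning

sparse : ∀ {n} → Subset n → Bool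
sparse []                 = true
sparse (false ∷ S)        = sparse S
sparse (true ∷ [])        = false
sparse (true ∷ false ∷ S) = sparse S
sparse (true ∷ true ∷ S)  = false

stalled : ∀ {m} → Subset (suc m) → Bool
stalled (false ∷ S) = sparse S
stalled (true ∷ S)  = false

#sparse : ℕ → ℕ → ℕ
#sparse m i = #subsets m (λ S → sparse S ∧ ofSize i S)

-- A sparse set on m+2 vertices starts with 0, or with 1 followed by 0.
#sparse-suc-suc : ∀ m i → #sparse (suc (suc m)) i ≡
  #sparse (suc m) i + #subsets m (λ S → sparse S ∧ (suc ∣ S ∣ ≡ᵇ i))
#sparse-suc-suc m i = trans (#subsets-suc (suc m) _)
  (cong (#sparse (suc m) i +_)
    (trans (#subsets-suc m _)
      (trans (cong (#subsets m (λ S → sparse S ∧ (suc ∣ S ∣ ≡ᵇ i)) +_) (count-false (subsets m)))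
             (+-identityʳ _))))

pascal-shifted : ∀ m j → (m ∸ j) C suc j + (m ∸ j) C j ≡ (suc m ∸ j) C suc j
pascal-shifted m j with m ≤? j
... | no m≰j = begin
  (m ∸ j) C suc j + (m ∸ j) C j ≡⟨ +-comm ((m ∸ j) C suc j) _ ⟩
  (m ∸ j) C j + (m ∸ j) C suc j ≡⟨ nCk+nC[k+1]≡[n+1]C[k+1] (m ∸ j) j ⟩
  suc (m ∸ j) C suc j           ≡⟨ cong (_C suc j) (sym (+-∸-assoc 1 (<⇒≤ (≰⇒> m≰j)))) ⟩
  (suc m ∸ j) C suc j           ∎
  where open ≡-Reasoning
... | yes m≤j = small j m≤j
  where
  -- Here m - j = 0 and m + 1 - j ≤ 1 < j + 1 unless m = j = 0.
  small : ∀ j → m ≤ j → (m ∸ j) C suc j + (m ∸ j) C j ≡ (suc m ∸ j) C suc j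
  small zero    z≤n = refl
  small (suc j) m≤j rewrite m≤n⇒m∸n≡0 m≤j =
    sym (k>n⇒nCk≡0 (s≤s (≤-trans (m∸n≤m m j) m≤j)))

#sparse≡ : ∀ m i → #sparse m i ≡ (m ∸ i) C i
#sparse≡ zero          zero    = refl
#sparse≡ zero          (suc i) = refl
#sparse≡ (suc zero)    zero    = refl
#sparse≡ (suc zero)    (suc i) rewrite 0∸n≡0 i = refl
#sparse≡ (suc (suc m)) zero    = begin
  #sparse (suc (suc m)) 0 ≡⟨ #sparse-suc-suc m 0 ⟩
  #sparse (suc m) 0 + #subsets m (λ S → sparse S ∧ false)
    ≡⟨ cong (#sparse (suc m) 0 +_) (trans (count-cong (λ S → ∧-zeroʳ (sparse S)) (subsets m)) (count-false (subsets m))) ⟩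
  #sparse (suc m) 0 + 0   ≡⟨ +-identityʳ _ ⟩
  #sparse (suc m) 0       ≡⟨ #sparse≡ (suc m) 0 ⟩
  1                       ∎
  where open ≡-Reasoning
#sparse≡ (suc (suc m)) (suc i) = begin
  #sparse (suc (suc m)) (suc i)       ≡⟨ #sparse-suc-suc m (suc i) ⟩
  #sparse (suc m) (suc i) + #sparse m i ≡⟨ cong₂ _+_ (#sparse≡ (suc m) (suc i)) (#sparse≡ m i) ⟩
  (m ∸ i) C suc i + (m ∸ i) C i       ≡⟨ pascal-shifted m i ⟩
  (suc m ∸ i) C suc i                 ∎
  where open ≡-Reasoning

#stalled≡ : ∀ m i → #subsets (suc m) (λ S → stalled S ∧ ofSize i S) ≡ (m ∸ i) C i
#stalled≡ m i = trans (#subsets-suc m _)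
  (trans (cong₂ _+_ (#sparse≡ m i) (count-false (subsets m))) (+-identityʳ _))

LastColored : ∀ {n} → Subset n → Set
LastColored {n} S = Σ (Fin n) λ f → suc (toℕ f) ≡ n × f ∈ S

AdjacentPair : ∀ {n} → Subset n → Set
AdjacentPair {n} S = Σ (Fin n) λ f → Σ (Fin n) λ g → suc (toℕ f) ≡ toℕ g × f ∈ S × g ∈ S

Trigger : ∀ {n} → Subset n → Set
Trigger S = LastColored S ⊎ AdjacentPair S

trigger-∷ : ∀ {n b} {S : Subset n} → Trigger S → Trigger (b ∷ S)
trigger-∷ (inj₁ (f , last , f∈S)) = inj₁ (suc f , cong suc last , there f∈S)
trigger-∷ (inj₂ (f , g , fg , f∈S , g∈S)) =
  inj₂ (suc f , suc g , cong suc fg , there f∈S , there g∈S)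

sparse-sound : ∀ {n} (S : Subset n) → sparse S ≡ true → ¬ Trigger S
sparse-sound (false ∷ S) sp (inj₁ (zero , _ , ()))
sparse-sound (false ∷ S) sp (inj₁ (suc f , last , there f∈S)) =
  sparse-sound S sp (inj₁ (f , suc-injective last , f∈S))
sparse-sound (false ∷ S) sp (inj₂ (zero , _ , _ , () , _))
sparse-sound (false ∷ S) sp (inj₂ (suc f , suc g , fg , there f∈S , there g∈S)) =
  sparse-sound S sp (inj₂ (f , g , suc-injective fg , f∈S , g∈S))
sparse-sound (true ∷ false ∷ S) sp (inj₁ (suc zero , _ , there ()))
sparse-sound (true ∷ false ∷ S) sp (inj₁ (suc (suc f) , last , there (there f∈S))) =
  sparse-sound S sp (inj₁ (f , suc-injective (suc-injective last) , f∈S))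
sparse-sound (true ∷ false ∷ S) sp (inj₂ (zero , suc zero , _ , _ , there ()))
sparse-sound (true ∷ false ∷ S) sp (inj₂ (suc zero , _ , _ , there () , _))
sparse-sound (true ∷ false ∷ S) sp
  (inj₂ (suc (suc f) , suc (suc g) , fg , there (there f∈S) , there (there g∈S))) =
  sparse-sound S sp (inj₂ (f , g , suc-injective (suc-injective fg) , f∈S , g∈S))

sparse-complete : ∀ {n} (S : Subset n) → sparse S ≡ false → Trigger S
sparse-complete (false ∷ S)        sp = trigger-∷ (sparse-complete S sp)
sparse-complete (true ∷ [])        _  = inj₁ (zero , refl , here)
sparse-complete (true ∷ false ∷ S) sp = trigger-∷ (trigger-∷ (sparse-complete S sp))
sparse-complete (true ∷ true ∷ S)  _  = inj₂ (zero , suc zero , refl , here , there here)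

stalled-sound : ∀ {m} (S : Subset (suc m)) → stalled S ≡ true → zero ∉ S × ¬ Trigger S
stalled-sound (false ∷ S) st = (λ ()) , sparse-sound (false ∷ S) st

stalled-complete : ∀ {m} (S : Subset (suc m)) → stalled S ≡ false → zero ∈ S ⊎ Trigger S
stalled-complete (true ∷ S)  _  = inj₁ here
stalled-complete (false ∷ S) st = inj₂ (sparse-complete (false ∷ S) st)

sides-differ : ∀ {n} {l u r : Fin n} → suc (toℕ l) ≡ toℕ u → suc (toℕ u) ≡ toℕ r → l ≢ r
sides-differ {l = l} lu ur refl =
  1+n≰n (subst (suc (toℕ l) ≤_) (trans (cong suc lu) ur) (n≤1+n (suc (toℕ l))))

-- Without vertex 0 and without a trigger, no vertex can force: the forcing
-- vertex would need its other neighbour colored, or to be an end vertex.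
no-force : ∀ {m} {S S′ : Subset (suc m)} → zero ∉ S → ¬ Trigger S → ¬ Force (Path (suc m)) S S′
no-force 0∉S _ (force zero v u∈S _ (inj₁ _) _) = 0∉S u∈S
no-force {m} _ no-trigger (force (suc u) v u∈S _ (inj₁ uv) others) =
  no-trigger (inj₂ (w , suc u , wu , others w (inj₂ wu) (sides-differ wu uv) , u∈S))
  where
  w : Fin (suc m)
  w = inject₁ u
  wu : suc (toℕ w) ≡ toℕ (suc u)
  wu = cong suc (toℕ-inject₁ u)
no-force {m} _ no-trigger (force u v u∈S _ (inj₂ vu) others) with suc (toℕ u) <? suc m
... | no u-last = no-trigger (inj₁ (u , ≤-antisym (toℕ<n u) (≮⇒≥ u-last) , u∈S))
... | yes u+1<n =
  no-trigger (inj₂ (u , w , uw , u∈S , others w (inj₁ uw) (≢-sym (sides-differ vu uw))))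
  where
  w : Fin (suc m)
  w = fromℕ< u+1<n
  uw : suc (toℕ u) ≡ toℕ w
  uw = sym (toℕ-fromℕ< u+1<n)

no-trigger-not-zero-forcing : ∀ {m} {S : Subset (suc m)} → zero ∉ S → ¬ Trigger S →
                              ¬ IsZeroForcingSet (Path (suc m)) S
no-trigger-not-zero-forcing 0∉S _          ε          = 0∉S ∈⊤
no-trigger-not-zero-forcing 0∉S no-trigger (step ◅ _) = no-force 0∉S no-trigger step

module _ {n : ℕ} where

  Reach : Subset n → Set
  Reach X = IsZeroForcingSet (Path n) X

  Covers : Subset n → ℕ → ℕ → Set
  Covers X a b = ∀ f → a ≤ toℕ f → toℕ f ≤ b → f ∈ X

  -- To let u force v it suffices to reach the end from any superset
  -- containing v (v may have been colored already, when no force is needed).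
  force-or-skip : ∀ {X} u v → u ∈ X → Path n u v → (∀ w → Path n u w → w ≢ v → w ∈ X) →
                  (∀ {Y} → X ⊆ Y → v ∈ Y → Reach Y) → Reach X
  force-or-skip {X} u v u∈X uv others continue with v ∈? X
  ... | yes v∈X = continue (λ x → x) v∈X
  ... | no  v∉X = force u v u∈X v∉X uv others
                ◅ continue (λ x → x∈p∪q⁺ (inj₁ x)) (x∈p∪q⁺ (inj₂ (x∈⁅x⁆ v)))

  covers-all : ∀ {X b} → Covers X 0 b → suc b ≡ n → X ≡ ⊤
  covers-all cov b+1≡n = ⊆-antisym ⊆⊤
    (λ {f} _ → cov f z≤n (≤-pred (subst (toℕ f <_) (sym b+1≡n) (toℕ<n f))))

  covers-point : ∀ {X f} → f ∈ X → Covers X (toℕ f) (toℕ f)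
  covers-point {X} f∈X x f≤x x≤f = subst (_∈ X) (toℕ-injective (≤-antisym f≤x x≤f)) f∈X

  covers-pair : ∀ {X f g} → suc (toℕ f) ≡ toℕ g → f ∈ X → g ∈ X → Covers X (toℕ f) (toℕ g)
  covers-pair {X} fg f∈X g∈X x f≤x x≤g with m≤n⇒m<n∨m≡n x≤g
  ... | inj₂ x≡g = subst (_∈ X) (sym (toℕ-injective x≡g)) g∈X
  ... | inj₁ x<g = subst (_∈ X)
    (toℕ-injective (≤-antisym f≤x (≤-pred (subst (toℕ x <_) (sym fg) x<g)))) f∈X

  extend-right : ∀ {X Y a b v} → Covers X a b → X ⊆ Y → v ∈ Y → toℕ v ≡ suc b →
                 Covers Y a (suc b)
  extend-right {Y = Y} cov X⊆Y v∈Y v≡b+1 f a≤f f≤b+1 with m≤n⇒m<n∨m≡n f≤b+1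
  ... | inj₁ f≤b   = X⊆Y (cov f a≤f (≤-pred f≤b))
  ... | inj₂ f≡b+1 = subst (_∈ Y) (sym (toℕ-injective (trans f≡b+1 (sym v≡b+1)))) v∈Y

  extend-left : ∀ {X Y a b v} → Covers X (suc a) b → X ⊆ Y → v ∈ Y → toℕ v ≡ a →
                Covers Y a b
  extend-left {Y = Y} cov X⊆Y v∈Y v≡a f a≤f f≤b with m≤n⇒m<n∨m≡n a≤f
  ... | inj₁ a<f = X⊆Y (cov f a<f f≤b)
  ... | inj₂ a≡f = subst (_∈ Y) (toℕ-injective (trans v≡a a≡f)) v∈Y

  left-neighbour : ∀ {u v w} → suc (toℕ u) ≡ toℕ v → Path n u w → w ≢ v → suc (toℕ w) ≡ toℕ u
  left-neighbour uv (inj₁ uw) w≢v = ⊥-elim (w≢v (toℕ-injective (trans (sym uw) uv)))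
  left-neighbour uv (inj₂ wu) _   = wu

  right-neighbour : ∀ {u v w} → suc (toℕ v) ≡ toℕ u → Path n u w → w ≢ v → suc (toℕ u) ≡ toℕ w
  right-neighbour vu (inj₁ uw) _   = uw
  right-neighbour vu (inj₂ wu) w≢v =
    ⊥-elim (w≢v (toℕ-injective (suc-injective (trans wu (sym vu)))))

  -- A colored prefix [0, b] spreads to the right (d vertices remain):
  -- vertex b forces b+1, its other neighbour lying in the prefix.
  grow-right : ∀ d b {X} → d + suc b ≡ n → Covers X 0 b → Reach X
  grow-right zero    b eq cov = subst Reach (sym (covers-all cov eq)) ε
  grow-right (suc d) b {X} eq cov =
    force-or-skip u v (cov u z≤n (≤-reflexive u≡b)) (inj₁ uv) others
      (λ X⊆Y v∈Y → grow-right d (suc b) (trans (+-suc d (suc b)) eq)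
                                         (extend-right cov X⊆Y v∈Y v≡b+1))
    where
    b+1<n : suc b < n
    b+1<n = subst (suc b <_) eq (s≤s (m≤n+m (suc b) d))
    b<n : b < n
    b<n = <-trans (n<1+n b) b+1<n
    u v : Fin n
    u = fromℕ< b<n
    v = fromℕ< b+1<n
    u≡b : toℕ u ≡ b
    u≡b = toℕ-fromℕ< b<n
    v≡b+1 : toℕ v ≡ suc b
    v≡b+1 = toℕ-fromℕ< b+1<n
    uv : suc (toℕ u) ≡ toℕ v
    uv = trans (cong suc u≡b) (sym v≡b+1)
    others : ∀ w → Path n u w → w ≢ v → w ∈ X
    others w u-w w≢v =
      cov w z≤n (≤-trans (n≤1+n _) (≤-reflexive (trans (left-neighbour uv u-w w≢v) u≡b)))

  right-of-left-end : ∀ {a b} → (a < b ⊎ suc b ≡ n) → ∀ w → suc a ≡ toℕ w → toℕ w ≤ b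
  right-of-left-end {b = b} (inj₁ a<b)   w a+1≡w = subst (_≤ b) a+1≡w a<b
  right-of-left-end         (inj₂ b+1≡n) w _     = ≤-pred (subst (toℕ w <_) (sym b+1≡n) (toℕ<n w))

  -- A colored interval [a, b] that is closed on the right (a < b, or b is the
  -- last vertex) spreads to the left: vertex a forces a-1, its right
  -- neighbour lying in the interval; at a = 0 it continues to the right.
  grow-left : ∀ a b {X} → a ≤ b → b < n → (a < b ⊎ suc b ≡ n) → Covers X a b → Reach X
  grow-left zero    b _ b<n _ cov = grow-right (n ∸ suc b) b (m∸n+n≡m b<n) cov
  grow-left (suc a) b {X} a+1≤b b<n closed cov =
    force-or-skip u v (cov u (≤-reflexive (sym u≡a+1)) (subst (_≤ b) (sym u≡a+1) a+1≤b))
                  (inj₂ vu) others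
      (λ X⊆Y v∈Y → grow-left a b (≤-trans (n≤1+n a) a+1≤b) b<n (inj₁ a+1≤b)
                                  (extend-left cov X⊆Y v∈Y v≡a))
    where
    a+1<n : suc a < n
    a+1<n = ≤-trans (s≤s a+1≤b) b<n
    a<n : a < n
    a<n = <-trans (n<1+n a) a+1<n
    u v : Fin n
    u = fromℕ< a+1<n
    v = fromℕ< a<n
    u≡a+1 : toℕ u ≡ suc a
    u≡a+1 = toℕ-fromℕ< a+1<n
    v≡a : toℕ v ≡ a
    v≡a = toℕ-fromℕ< a<n
    vu : suc (toℕ v) ≡ toℕ u
    vu = trans (cong suc v≡a) (sym u≡a+1)
    others : ∀ w → Path n u w → w ≢ v → w ∈ X
    others w u-w w≢v = cov w (≤-trans (n≤1+n _) (≤-reflexive w≡a+2)) (right-of-left-end closed w w≡a+2)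
      where
      w≡a+2 : suc (suc a) ≡ toℕ w
      w≡a+2 = trans (cong suc (sym u≡a+1)) (right-neighbour vu u-w w≢v)

seed-zero-forcing : ∀ {m} (S : Subset (suc m)) → zero ∈ S ⊎ Trigger S →
                    IsZeroForcingSet (Path (suc m)) S
seed-zero-forcing {m} S (inj₁ 0∈S) = grow-right m 0 (+-comm m 1) (covers-point 0∈S)
seed-zero-forcing S (inj₂ (inj₁ (f , last , f∈S))) =
  grow-left (toℕ f) (toℕ f) ≤-refl (toℕ<n f) (inj₂ last) (covers-point f∈S)
seed-zero-forcing S (inj₂ (inj₂ (f , g , fg , f∈S , g∈S))) =
  grow-left (toℕ f) (toℕ g) (subst (toℕ f ≤_) fg (n≤1+n _)) (toℕ<n g)
            (inj₁ (≤-reflexive fg)) (covers-pair fg f∈S g∈S)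

zero-forcing⇔not-stalled : ∀ {m} (S : Subset (suc m)) →
                           IsZeroForcingSet (Path (suc m)) S ⇔ T (not (stalled S))
zero-forcing⇔not-stalled S = mk⇔ not-stalled zero-forcing
  where
  not-stalled : IsZeroForcingSet _ S → T (not (stalled S))
  not-stalled zf with stalled S in st
  ... | true  = ⊥-elim (uncurry no-trigger-not-zero-forcing (stalled-sound S st) zf)
  ... | false = tt
  zero-forcing : T (not (stalled S)) → IsZeroForcingSet _ S
  zero-forcing ns = seed-zero-forcing S (stalled-complete S (Equivalence.to T-not-≡ ns))

zeroForcingOfSize : ∀ {m} → ℕ → Subset (suc m) → Bool
zeroForcingOfSize i S = not (stalled S) ∧ ofSize i S

zeroForcingOfSize-spec : ∀ {m} i (S : Subset (suc m)) →
  T (zeroForcingOfSize i S) ⇔ (∣ S ∣ ≡ i × IsZeroForcingSet (Path (suc m)) S)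
zeroForcingOfSize-spec i S = mk⇔
  (λ t → let (ns , sz) = Equivalence.to T-∧ t in
         ≡ᵇ⇒≡ _ _ sz , Equivalence.from (zero-forcing⇔not-stalled S) ns)
  (λ (sz , zf) → Equivalence.from T-∧
         (Equivalence.to (zero-forcing⇔not-stalled S) zf , ≡⇒≡ᵇ _ _ sz))

zcount-path : ∀ m i → ZCount (Path (suc m)) i (#subsets (suc m) (zeroForcingOfSize i))
zcount-path m i with enumerate (zeroForcingOfSize i)
... | L , unique , len , mem = L , unique , len , λ S → zeroForcingOfSize-spec i S ⇔-∘ mem S

#zeroForcing+#stalled : ∀ m i →
  #subsets (suc m) (zeroForcingOfSize i) + (m ∸ i) C i ≡ suc m C i
#zeroForcing+#stalled m i = begin
  #subsets (suc m) (zeroForcingOfSize i) + (m ∸ i) C i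
    ≡⟨ cong (#subsets (suc m) (zeroForcingOfSize i) +_) (sym (#stalled≡ m i)) ⟩
  #subsets (suc m) (zeroForcingOfSize i) + #subsets (suc m) (λ S → stalled S ∧ ofSize i S)
    ≡⟨ count-partition stalled (ofSize i) (subsets (suc m)) ⟩
  #subsets (suc m) (ofSize i)
    ≡⟨ #ofSize (suc m) i ⟩
  suc m C i ∎
  where open ≡-Reasoning

-- The identity holds for every i.
proposition4p3 : (n : ℕ) → 1 ≤ n → (i : ℕ) → 1 ≤ i → i ≤ n →
    Σ ℕ λ k → ZCount (Path n) i k × k + ((n ∸ i ∸ 1) C i) ≡ n C i
proposition4p3 (suc m) _ i _ _ =
  #subsets (suc m) (zeroForcingOfSize i) , zcount-path m i ,
  trans (cong (λ r → #subsets (suc m) (zeroForcingOfSize i) + r C i) index)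
        (#zeroForcing+#stalled m i)
  where
  index : suc m ∸ i ∸ 1 ≡ m ∸ i
  index = trans (∸-+-assoc (suc m) i 1) (cong (suc m ∸_) (+-comm i 1))
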